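{- Let $\rho$ be a polymatroid on a finite set $E$. If $A$ is a flat of $\rho$, then $\mathrm{cy}_\rho(A)$ is a flat of $\rho$, and hence a cyclic flat of $\rho$.
   Context: A polymatroid on a finite set $E$ is a function $\rho:2^E\to\mathbb{R}$ with $\rho(\emptyset)=0$, monotone and submodular. $A\subseteq E$ is a flat if $\rho(A\cup\{i\})>\rho(A)$ for all $i\in E-A$; $A$ is cyclic if $\rho(A)<\rho(A-\{i\})+\rho(\{i\})$ for all $i\in A$ with $\rho(\{i\})>0$; a cyclic flat is a set that is both. $\mathrm{cy}_\rho(A)$ is the union of all cyclic sets contained in $A$. -}

module Defs where

open import Level using (Level; suc; _⊔_)
open import Data.Nat using (ℕ)
open import Data.Fin using (Fin)
open import Data.Fin.Subset using (Subset; ⊥; ⁅_⁆; _∈_; _∉_; _⊆_; _∪_; _∩_; _-_)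
open import Data.Product using (_×_; Σ; ∃)
open import Relation.Nullary using (¬_)
open import Relation.Binary.PropositionalEquality using (_≡_)
open import Relation.Binary.Structures using (IsTotalOrder)
open import Algebra.Structures using (IsAbelianGroup)

-- A totally ordered abelian group (e.g. (ℝ, +, 0, ≤)); the value domain of ρ.
-- The polymatroid values in the paper are real numbers; ℝ is an instance.
record OrderedAbelianGroup (c ℓ : Level) : Set (suc (c ⊔ ℓ)) where
  infixl 6 _+_
  infix 4 _≤_ _<_
  field
    Carrier        : Set c
    _+_            : Carrier → Carrier → Carrier
    0#             : Carrier
    neg            : Carrier → Carrier
    _≤_            : Carrier → Carrier → Set ℓ
    isAbelianGroup : IsAbelianGroup _≡_ _+_ 0# neg
    isTotalOrder   : IsTotalOrder _≡_ _≤_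
    +-monoˡ-≤      : ∀ {x y} z → x ≤ y → x + z ≤ y + z

  _<_ : Carrier → Carrier → Set (c ⊔ ℓ)
  x < y = x ≤ y × ¬ (x ≡ y)

module _ {c ℓ : Level} (G : OrderedAbelianGroup c ℓ) {n : ℕ} where
  open OrderedAbelianGroup G

  record IsPolymatroid (ρ : Subset n → Carrier) : Set (c ⊔ ℓ) where
    field
      empty       : ρ ⊥ ≡ 0#
      monotone    : ∀ {X Y} → X ⊆ Y → ρ X ≤ ρ Y
      submodular  : ∀ X Y → ρ (X ∪ Y) + ρ (X ∩ Y) ≤ ρ X + ρ Y

  IsFlat : (Subset n → Carrier) → Subset n → Set (c ⊔ ℓ)
  IsFlat ρ A = ∀ i → i ∉ A → ρ A < ρ (A ∪ ⁅ i ⁆)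

  IsCyclic : (Subset n → Carrier) → Subset n → Set (c ⊔ ℓ)
  IsCyclic ρ A = ∀ i → i ∈ A → 0# < ρ ⁅ i ⁆ → ρ A < ρ (A - i) + ρ ⁅ i ⁆

  IsCyclicFlat : (Subset n → Carrier) → Subset n → Set (c ⊔ ℓ)
  IsCyclicFlat ρ A = IsFlat ρ A × IsCyclic ρ A

  IsCy : (Subset n → Carrier) → Subset n → Subset n → Set (c ⊔ ℓ)
  IsCy ρ A X = ∀ i → (i ∈ X → Σ (Subset n) λ C → IsCyclic ρ C × C ⊆ A × i ∈ C)
                   × ((Σ (Subset n) λ C → IsCyclic ρ C × C ⊆ A × i ∈ C) → i ∈ X)

-- A cyclic set C ⊆ Y containing i forces ρ Y < ρ (Y - i) + ρ ⁅ i ⁆ by submodularity, so the union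
-- cy(A) of all cyclic subsets of A is itself cyclic. For flatness of X = cy(A) at i ∉ X: if i ∉ A,
-- the marginal gain of i at X ⊆ A dominates the positive gain at the flat A; if i ∈ A and adding i
-- did not raise the rank, then X ∪ ⁅ i ⁆ would be a cyclic subset of A, hence contained in X.
module Submission where

open import Defs
open import Level using (Level; _⊔_)
open import Data.Nat using (ℕ)
open import Data.Fin using (Fin)
open import Data.Fin.Properties using (_≟_)
open import Data.Fin.Subset using (Subset; ⁅_⁆; _∈_; _∉_; _⊆_; _∪_; _∩_; _─_; _-_; outside)
open import Data.Fin.Subset.Properties
  using (p⊆p∪q; q⊆p∪q; x∈p∪q⁻; x∈p∩q⁺; p─q⊆p; x∈⁅x⁆; x∈⁅y⁆⇒x≡y; x∈p∧x≢y⇒x∈p-y; _∈?_)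
open import Data.Product using (_,_; proj₁; proj₂)
open import Data.Sum using (inj₁; inj₂)
open import Relation.Nullary using (yes; no; contradiction)
open import Relation.Binary.PropositionalEquality using (_≡_; _≢_; refl; sym; cong)
open import Relation.Binary.Bundles using (Poset)
open import Relation.Binary.Structures using (IsTotalOrder)
open import Algebra.Bundles using (AbelianGroup)
import Algebra.Properties.Group as GroupProperties
import Algebra.Properties.CommutativeSemigroup as CommutativeSemigroupProperties
open import Data.Vec using (_∷_; here; there)
import Relation.Binary.Reasoning.PartialOrder as PartialOrderReasoning

x∈p─q⇒x∉q : ∀ {n} {x : Fin n} (p q : Subset n) → x ∈ p ─ q → x ∉ q
x∈p─q⇒x∉q (_ ∷ p) (outside ∷ q) here          ()
x∈p─q⇒x∉q (_ ∷ p) (_ ∷ q)       (there x∈p─q) (there x∈q) = x∈p─q⇒x∉q p q x∈p─q x∈q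

x∈p-y⇒x≢y : ∀ {n} {x y : Fin n} (p : Subset n) → x ∈ p - y → x ≢ y
x∈p-y⇒x≢y {y = y} p x∈p-y refl = x∈p─q⇒x∉q p ⁅ y ⁆ x∈p-y (x∈⁅x⁆ y)

module OrderedAbelianGroupProperties {c ℓ : Level} (G : OrderedAbelianGroup c ℓ) where
  open OrderedAbelianGroup G

  abelianGroup : AbelianGroup c c
  abelianGroup = record { isAbelianGroup = isAbelianGroup }

  poset : Poset c c ℓ
  poset = record { isPartialOrder = IsTotalOrder.isPartialOrder isTotalOrder }

  open AbelianGroup abelianGroup public using (comm)
  open AbelianGroup abelianGroup using (identityˡ; group; commutativeSemigroup)
  open GroupProperties group using (//-rightDividesʳ)
  open CommutativeSemigroupProperties commutativeSemigroup public using (xy∙z≈zy∙x)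
  open PartialOrderReasoning poset public

  +-mono-≤ : ∀ {x y u v} → x ≤ y → u ≤ v → x + u ≤ y + v
  +-mono-≤ {x} {y} {u} {v} x≤y u≤v = begin
    x + u  ≤⟨ +-monoˡ-≤ u x≤y ⟩
    y + u  ≡⟨ comm y u ⟩
    u + y  ≤⟨ +-monoˡ-≤ y u≤v ⟩
    v + y  ≡⟨ comm v y ⟩
    y + v  ∎

  +-cancelʳ-≤ : ∀ {x y} z → x + z ≤ y + z → x ≤ y
  +-cancelʳ-≤ {x} {y} z x+z≤y+z = begin
    x              ≡⟨ //-rightDividesʳ z x ⟨
    x + z + neg z  ≤⟨ +-monoˡ-≤ (neg z) x+z≤y+z ⟩
    y + z + neg z  ≡⟨ //-rightDividesʳ z y ⟩
    y              ∎

  +-monoˡ-< : ∀ {x y} z → x < y → x + z < y + z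
  +-monoˡ-< {x} {y} z (x≤y , x≢y) = +-monoˡ-≤ z x≤y , λ x+z≡y+z → x≢y (begin-equality
    x              ≡⟨ //-rightDividesʳ z x ⟨
    x + z + neg z  ≡⟨ cong (_+ neg z) x+z≡y+z ⟩
    y + z + neg z  ≡⟨ //-rightDividesʳ z y ⟩
    y              ∎)

  +-cancelʳ-< : ∀ {x y} z → x + z < y + z → x < y
  +-cancelʳ-< z (x+z≤y+z , x+z≢y+z) = +-cancelʳ-≤ z x+z≤y+z , λ { refl → x+z≢y+z refl }

  x<x+y : ∀ {x y} → 0# < y → x < x + y
  x<x+y {x} {y} 0<y = begin-strict
    x       ≡⟨ identityˡ x ⟨
    0# + x  <⟨ +-monoˡ-< x 0<y ⟩
    y + x   ≡⟨ comm y x ⟩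
    x + y   ∎

module Polymatroid {c ℓ : Level} (G : OrderedAbelianGroup c ℓ) {n : ℕ}
    (ρ : Subset n → OrderedAbelianGroup.Carrier G) (isPolymatroid : IsPolymatroid G ρ) where
  open OrderedAbelianGroup G
  open OrderedAbelianGroupProperties G
  open IsPolymatroid isPolymatroid

  submodular-⊆ : ∀ {U I} Y Z → U ⊆ Y ∪ Z → I ⊆ Y ∩ Z → ρ U + ρ I ≤ ρ Y + ρ Z
  submodular-⊆ {U} {I} Y Z U⊆Y∪Z I⊆Y∩Z = begin
    ρ U + ρ I              ≤⟨ +-mono-≤ (monotone U⊆Y∪Z) (monotone I⊆Y∩Z) ⟩
    ρ (Y ∪ Z) + ρ (Y ∩ Z)  ≤⟨ submodular Y Z ⟩
    ρ Y + ρ Z              ∎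

  IsCyclicAt : Subset n → Fin n → Set (c ⊔ ℓ)
  IsCyclicAt Y i = 0# < ρ ⁅ i ⁆ → ρ Y < ρ (Y - i) + ρ ⁅ i ⁆

  cyclic-⊆⇒cyclicAt : ∀ {C Y i} → IsCyclic G ρ C → C ⊆ Y → i ∈ C → IsCyclicAt Y i
  cyclic-⊆⇒cyclicAt {C} {Y} {i} cyclicC C⊆Y i∈C 0<ρi = +-cancelʳ-< (ρ (C - i)) (begin-strict
    ρ Y + ρ (C - i)                  ≤⟨ submodular-⊆ C (Y - i) Y⊆C∪Y-i C-i⊆C∩Y-i ⟩
    ρ C + ρ (Y - i)                  <⟨ +-monoˡ-< (ρ (Y - i)) (cyclicC i i∈C 0<ρi) ⟩
    ρ (C - i) + ρ ⁅ i ⁆ + ρ (Y - i)  ≡⟨ xy∙z≈zy∙x (ρ (C - i)) (ρ ⁅ i ⁆) (ρ (Y - i)) ⟩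
    ρ (Y - i) + ρ ⁅ i ⁆ + ρ (C - i)  ∎)
    where
    Y⊆C∪Y-i : Y ⊆ C ∪ (Y - i)
    Y⊆C∪Y-i {j} j∈Y with j ≟ i
    ... | yes refl = p⊆p∪q (Y - i) i∈C
    ... | no j≢i   = q⊆p∪q C (Y - i) (x∈p∧x≢y⇒x∈p-y j∈Y j≢i)
    C-i⊆C∩Y-i : C - i ⊆ C ∩ (Y - i)
    C-i⊆C∩Y-i j∈C-i = x∈p∩q⁺ (j∈C , x∈p∧x≢y⇒x∈p-y (C⊆Y j∈C) (x∈p-y⇒x≢y C j∈C-i))
      where j∈C = p─q⊆p C ⁅ i ⁆ j∈C-i

  cyclic-∪-spanned-element : ∀ {X i} → IsCyclic G ρ X → i ∉ X → ρ (X ∪ ⁅ i ⁆) ≡ ρ X →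
                             IsCyclic G ρ (X ∪ ⁅ i ⁆)
  cyclic-∪-spanned-element {X} {i} cyclicX i∉X ρX∪i≡ρX j j∈X∪i with j ≟ i
  ... | yes refl = λ 0<ρi → begin-strict
    ρ (X ∪ ⁅ i ⁆)                ≡⟨ ρX∪i≡ρX ⟩
    ρ X                          <⟨ x<x+y 0<ρi ⟩
    ρ X + ρ ⁅ i ⁆                ≤⟨ +-monoˡ-≤ (ρ ⁅ i ⁆) (monotone X⊆X∪i-i) ⟩
    ρ (X ∪ ⁅ i ⁆ - i) + ρ ⁅ i ⁆  ∎
    where
    X⊆X∪i-i : X ⊆ X ∪ ⁅ i ⁆ - i
    X⊆X∪i-i k∈X = x∈p∧x≢y⇒x∈p-y (p⊆p∪q ⁅ i ⁆ k∈X) λ { refl → i∉X k∈X }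
  ... | no j≢i with x∈p∪q⁻ X ⁅ i ⁆ j∈X∪i
  ...   | inj₁ j∈X = cyclic-⊆⇒cyclicAt cyclicX (p⊆p∪q ⁅ i ⁆) j∈X
  ...   | inj₂ j∈⁅i⁆ = contradiction (x∈⁅y⁆⇒x≡y i j∈⁅i⁆) j≢i

  flat-⊇⇒rank-increases : ∀ {A X i} → IsFlat G ρ A → X ⊆ A → i ∉ A → ρ X < ρ (X ∪ ⁅ i ⁆)
  flat-⊇⇒rank-increases {A} {X} {i} flatA X⊆A i∉A = +-cancelʳ-< (ρ A) (begin-strict
    ρ X + ρ A              ≡⟨ comm (ρ X) (ρ A) ⟩
    ρ A + ρ X              <⟨ +-monoˡ-< (ρ X) (flatA i i∉A) ⟩
    ρ (A ∪ ⁅ i ⁆) + ρ X    ≤⟨ submodular-⊆ (X ∪ ⁅ i ⁆) A A∪i⊆X∪i∪A X⊆X∪i∩A ⟩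
    ρ (X ∪ ⁅ i ⁆) + ρ A    ∎)
    where
    A∪i⊆X∪i∪A : A ∪ ⁅ i ⁆ ⊆ (X ∪ ⁅ i ⁆) ∪ A
    A∪i⊆X∪i∪A j∈A∪i with x∈p∪q⁻ A ⁅ i ⁆ j∈A∪i
    ... | inj₁ j∈A   = q⊆p∪q (X ∪ ⁅ i ⁆) A j∈A
    ... | inj₂ j∈⁅i⁆ = p⊆p∪q A (q⊆p∪q X ⁅ i ⁆ j∈⁅i⁆)
    X⊆X∪i∩A : X ⊆ (X ∪ ⁅ i ⁆) ∩ A
    X⊆X∪i∩A j∈X = x∈p∩q⁺ (p⊆p∪q ⁅ i ⁆ j∈X , X⊆A j∈X)

  module _ {A X : Subset n} (X-is-cy : IsCy G ρ A X) where

    cy⊆ : X ⊆ A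
    cy⊆ {j} j∈X with proj₁ (X-is-cy j) j∈X
    ... | _ , _ , C⊆A , j∈C = C⊆A j∈C

    cyclic-⊆⇒⊆cy : ∀ {C} → IsCyclic G ρ C → C ⊆ A → C ⊆ X
    cyclic-⊆⇒⊆cy {C} cyclicC C⊆A {j} j∈C = proj₂ (X-is-cy j) (C , cyclicC , C⊆A , j∈C)

    cy-cyclic : IsCyclic G ρ X
    cy-cyclic i i∈X with proj₁ (X-is-cy i) i∈X
    ... | C , cyclicC , C⊆A , i∈C = cyclic-⊆⇒cyclicAt cyclicC (cyclic-⊆⇒⊆cy cyclicC C⊆A) i∈C

    cy-flat : IsFlat G ρ A → IsFlat G ρ X
    cy-flat flatA i i∉X with i ∈? A
    ... | no i∉A = flat-⊇⇒rank-increases flatA cy⊆ i∉A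
    ... | yes i∈A = monotone (p⊆p∪q ⁅ i ⁆) , λ ρX≡ρX∪i →
      i∉X (cyclic-⊆⇒⊆cy (cyclic-∪-spanned-element cy-cyclic i∉X (sym ρX≡ρX∪i))
                        X∪i⊆A (q⊆p∪q X ⁅ i ⁆ (x∈⁅x⁆ i)))
      where
      X∪i⊆A : X ∪ ⁅ i ⁆ ⊆ A
      X∪i⊆A j∈X∪i with x∈p∪q⁻ X ⁅ i ⁆ j∈X∪i
      ... | inj₁ j∈X   = cy⊆ j∈X
      ... | inj₂ j∈⁅i⁆ rewrite x∈⁅y⁆⇒x≡y i j∈⁅i⁆ = i∈A

lemma5p14 : {c ℓ : Level} (G : OrderedAbelianGroup c ℓ) (n : ℕ)
            (ρ : Subset n → OrderedAbelianGroup.Carrier G) →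
            IsPolymatroid G ρ →
            (A : Subset n) → IsFlat G ρ A →
            (X : Subset n) → IsCy G ρ A X →
            IsCyclicFlat G ρ X
lemma5p14 G n ρ isPolymatroid A flatA X X-is-cy = cy-flat X-is-cy flatA , cy-cyclic X-is-cy
  where open Polymatroid G ρ isPolymatroid
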